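{- Let $G$ be a graph and let $m_1,m_2$ be nonnegative integers. If $G[X,Y]$ is $(m_1+m_2+1)$-tree-connected for a bipartition $X,Y$ of $V(G)$, then $G$ can be decomposed into two factors $G_1$ and $G_2$ (i.e. $E(G)$ is the disjoint union of $E(G_1)$ and $E(G_2)$) such that $G_1$ is an $m_1$-tree-connected bipartite graph with bipartition $(X,Y)$, and $G_2$ is an $m_2$-tree-connected Eulerian graph.
   Context: Graphs may have loops and multiple edges. A factor is a spanning subgraph. $G[X,Y]$ denotes the spanning bipartite subgraph of $G$ consisting of all edges with one end in $X$ and the other in $Y$. A graph is $m$-tree-connected if it contains $m$ edge-disjoint spanning trees. A graph is Eulerian if every vertex has even degree. -}

module Defs where

open import Data.Nat using (ℕ; zero; suc; _+_)
open import Data.Nat.Divisibility using (_∣_)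
open import Data.Fin using (Fin; zero; suc)
open import Data.Fin.Properties using (_≟_)
open import Data.Bool using (Bool; true; false; _xor_)
open import Data.Product using (Σ; _×_; _,_; proj₁; proj₂)
open import Data.Sum using (_⊎_)
open import Data.List using (List; []; _∷_)
open import Data.List.Relation.Unary.Unique.Propositional using (Unique)
open import Relation.Binary.PropositionalEquality using (_≡_)
open import Relation.Nullary using (yes; no)

-- A finite multigraph (loops and parallel edges allowed):
-- vertices Fin n, edges Fin m, each edge with an (unordered) pair of ends.
record Graph : Set where
  field
    n    : ℕ
    m    : ℕ
    ends : Fin m → Fin n × Fin n
open Graph public

-- A factor (spanning subgraph) of G is given by its edge set.
EdgeSet : Graph → Set
EdgeSet G = Fin (m G) → Bool

-- Vertex subsets (used for the side X of a bipartition; Y is the complement).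
VertexSet : Graph → Set
VertexSet G = Fin (n G) → Bool

Joins : (G : Graph) → EdgeSet G → Fin (n G) → Fin (n G) → Fin (m G) → Set
Joins G S u v i = (S i ≡ true) × ((ends G i ≡ (u , v)) ⊎ (ends G i ≡ (v , u)))

data Walk (G : Graph) (S : EdgeSet G) : Fin (n G) → Fin (n G) → Set where
  []  : ∀ {u} → Walk G S u u
  step : ∀ {u w v} (i : Fin (m G)) → Joins G S u w i → Walk G S w v → Walk G S u v

edgesOf : ∀ {G S u v} → Walk G S u v → List (Fin (m G))
edgesOf []             = []
edgesOf (step i _ w)   = i ∷ edgesOf w

Connected : (G : Graph) → EdgeSet G → Set
Connected G S = ∀ (u v : Fin (n G)) → Walk G S u v

-- no cycles: every closed walk without repeated edges is empty
-- (a loop, or two parallel edges, count as cycles)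
Acyclic : (G : Graph) → EdgeSet G → Set
Acyclic G S = ∀ (u : Fin (n G)) (w : Walk G S u u) → Unique (edgesOf w) → edgesOf w ≡ []

SubEdges : (G : Graph) → EdgeSet G → EdgeSet G → Set
SubEdges G T S = ∀ (i : Fin (m G)) → T i ≡ true → S i ≡ true

SpanningTree : (G : Graph) → EdgeSet G → EdgeSet G → Set
SpanningTree G S T = SubEdges G T S × Connected G T × Acyclic G T

TreeConnected : ℕ → (G : Graph) → EdgeSet G → Set
TreeConnected k G S =
  Σ (Fin k → EdgeSet G) λ T →
    (∀ j → SpanningTree G S (T j)) ×
    (∀ j j' i → T j i ≡ true → T j' i ≡ true → j ≡ j')

-- G[X,Y] with Y the complement of X: edges with one end in X and the other in Y
Cross : (G : Graph) → VertexSet G → EdgeSet G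
Cross G X i = X (proj₁ (ends G i)) xor X (proj₂ (ends G i))

BipartiteWith : (G : Graph) → VertexSet G → EdgeSet G → Set
BipartiteWith G X S = SubEdges G S (Cross G X)

∑ : ∀ k → (Fin k → ℕ) → ℕ
∑ zero    f = 0
∑ (suc k) f = f zero + ∑ k (λ i → f (suc i))

endCount : ∀ {N} → Fin N → Fin N → ℕ
endCount v a with a ≟ v
... | yes _ = 1
... | no  _ = 0

-- degree of v in the factor S (a loop contributes 2)
degree : (G : Graph) → EdgeSet G → Fin (n G) → ℕ
degree G S v = ∑ (m G) λ i → contrib (S i) i
  where
  contrib : Bool → Fin (m G) → ℕ
  contrib false i = 0
  contrib true  i = endCount v (proj₁ (ends G i)) + endCount v (proj₂ (ends G i))

Eulerian : (G : Graph) → EdgeSet G → Set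
Eulerian G S = ∀ v → 2 ∣ degree G S v

{-# OPTIONS --safe #-}
-- Of the m₁ + m₂ + 1 edge-disjoint spanning trees of G[X,Y], the first m₁ go to G₁, and every edge
-- outside them starts in G₂.  The one spare tree is made of bipartite edges lying in no other tree,
-- so its edges may be toggled between G₁ and G₂ freely.  Toggling the edges of a walk of the spare
-- tree from y to a fixed root r changes degree parities exactly at y and r, so the odd vertices other
-- than r are repaired one at a time; r is then even by the handshake lemma.
module Submission where

open import Defs
open import Data.Nat using (ℕ; zero; suc; _+_; parity)
open import Data.Nat.Properties using (+-0-commutativeMonoid; +-comm)
open import Data.Nat.Divisibility using (_∣_; _∣0; n∣n; ∣m∣n⇒∣m+n)
open import Data.Parity.Base as ℙ using (Parity; 0ℙ; 1ℙ)
open import Data.Parity.Properties as ℙ using (+-homo-+)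
open import Data.Bool using (Bool; true; false; not; if_then_else_)
open import Data.Bool.Properties using (not-involutive; ¬-not) renaming (_≟_ to _≟ᵇ_)
open import Data.Fin using (Fin; zero; suc; punchIn; splitAt; _↑ˡ_; _↑ʳ_)
open import Data.Fin.Properties
  using (_≟_; ¬Fin0; any?; punchInᵢ≢i; splitAt-↑ˡ; splitAt-↑ʳ; ↑ˡ-injective; ↑ʳ-injective)
open import Data.Vec.Functional using (updateAt; removeAt)
open import Data.Vec.Functional.Properties using (updateAt-updates; updateAt-minimal)
open import Data.List using (List; []; _∷_; allFin)
open import Data.List.Membership.Propositional using (_∈_)
open import Data.List.Membership.Propositional.Properties using (∈-allFin)
open import Data.List.Relation.Unary.Any using (here; there)
open import Data.Product using (Σ; ∃; _×_; _,_; proj₁; proj₂)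
open import Data.Sum using (inj₁; inj₂)
open import Function using (_∘_)
open import Relation.Binary.PropositionalEquality
open import Relation.Nullary using (Dec; yes; no; ¬_; contradiction)
open import Relation.Nullary.Decidable using (does; dec-true; dec-false)
open import Algebra.Properties.CommutativeMonoid.Sum +-0-commutativeMonoid
  using (sum; sum-cong-≗; sum-remove; ∑-distrib-+; ∑-comm; sum-replicate-zero)
import Algebra.Solver.Ring.Simple as RingSolver
import Algebra.Solver.Ring.AlmostCommutativeRing as ACR

module ℙ-Solver = RingSolver (ACR.fromCommutativeRing ℙ.+-*-commutativeRing) ℙ._≟_

∑≡sum : ∀ k (f : Fin k → ℕ) → ∑ k f ≡ sum f
∑≡sum zero    f = refl
∑≡sum (suc k) f = cong (f zero +_) (∑≡sum k (f ∘ suc))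

sum-insert : ∀ {k} (f g : Fin k → ℕ) (e : Fin k) →
             (∀ i → i ≢ e → g i ≡ f i) → f e ≡ 0 → sum g ≡ sum f + g e
sum-insert {suc k} f g e agree fe≡0 = begin
  sum g                     ≡⟨ sum-remove {i = e} g ⟩
  g e + sum (removeAt g e)  ≡⟨ cong (g e +_) (sum-cong-≗ λ j → agree (punchIn e j) (punchInᵢ≢i e j)) ⟩
  g e + sum (removeAt f e)  ≡⟨ cong (g e +_) sum-f ⟨
  g e + sum f               ≡⟨ +-comm (g e) (sum f) ⟩
  sum f + g e               ∎
  where
  open ≡-Reasoning
  sum-f : sum f ≡ sum (removeAt f e)
  sum-f = trans (sum-remove {i = e} f) (cong (_+ sum (removeAt f e)) fe≡0)

parity-sum-even : ∀ {k} (f : Fin k → ℕ) → (∀ i → parity (f i) ≡ 0ℙ) → parity (sum f) ≡ 0ℙ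
parity-sum-even {zero}  f even = refl
parity-sum-even {suc k} f even =
  trans (+-homo-+ (f zero) _) (cong₂ ℙ._+_ (even zero) (parity-sum-even (f ∘ suc) (even ∘ suc)))

parity-sum-single : ∀ {k} (f : Fin k → ℕ) (r : Fin k) →
                    (∀ i → i ≢ r → parity (f i) ≡ 0ℙ) → parity (sum f) ≡ parity (f r)
parity-sum-single {suc k} f r even = begin
  parity (sum f)                                ≡⟨ cong parity (sum-remove {i = r} f) ⟩
  parity (f r + sum (removeAt f r))             ≡⟨ +-homo-+ (f r) _ ⟩
  parity (f r) ℙ.+ parity (sum (removeAt f r))  ≡⟨ cong (parity (f r) ℙ.+_)
                                                     (parity-sum-even _ λ j → even _ (punchInᵢ≢i r j)) ⟩
  parity (f r) ℙ.+ 0ℙ                           ≡⟨ ℙ.+-identityʳ _ ⟩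
  parity (f r)                                  ∎
  where open ≡-Reasoning

parity≡0ℙ⇒2∣ : ∀ k → parity k ≡ 0ℙ → 2 ∣ k
parity≡0ℙ⇒2∣ zero          _    = 2 ∣0
parity≡0ℙ⇒2∣ (suc (suc k)) even = ∣m∣n⇒∣m+n (n∣n {2}) (parity≡0ℙ⇒2∣ k even)

endCount-self : ∀ {k} (a : Fin k) → endCount a a ≡ 1
endCount-self a with a ≟ a
... | yes _   = refl
... | no a≢a = contradiction refl a≢a

endCount-other : ∀ {k} {v a : Fin k} → a ≢ v → endCount v a ≡ 0
endCount-other {v = v} {a} a≢v with a ≟ v
... | yes a≡v = contradiction a≡v a≢v
... | no _    = refl

sum-endCount : ∀ {k} (a : Fin k) → sum (λ v → endCount v a) ≡ 1
sum-endCount {suc k} a = begin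
  sum (λ v → endCount v a)                             ≡⟨ sum-remove {i = a} (λ v → endCount v a) ⟩
  endCount a a + sum (λ j → endCount (punchIn a j) a)  ≡⟨ cong₂ _+_ (endCount-self a) others ⟩
  1 + sum (λ (_ : Fin k) → 0)                          ≡⟨ cong (1 +_) (sum-replicate-zero k) ⟩
  1                                                    ∎
  where
  open ≡-Reasoning
  others : sum (λ j → endCount (punchIn a j) a) ≡ sum (λ (_ : Fin k) → 0)
  others = sum-cong-≗ λ j → endCount-other (punchInᵢ≢i a j ∘ sym)

module _ (G : Graph) where

  incidence : Fin (n G) → Fin (m G) → ℕ
  incidence v i = endCount v (proj₁ (ends G i)) + endCount v (proj₂ (ends G i))

  incidenceIn : EdgeSet G → Fin (n G) → Fin (m G) → ℕ
  incidenceIn S v i = if S i then incidence v i else 0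

  -- The summand of `degree` is local to Defs; unification recovers it from constant edge sets.
  degree-as-sum : ∀ S v → degree G S v ≡ sum (incidenceIn S v)
  degree-as-sum S v = trans (∑≡sum (m G) _) (sum-cong-≗ λ i → by-cases (S i) i)
    where
    summand : Σ (Bool → Fin (m G) → ℕ) λ f → ∀ b → degree G (λ _ → b) v ≡ ∑ (m G) (f b)
    summand = _ , λ b → refl
    by-cases : ∀ b i → proj₁ summand b i ≡ (if b then incidence v i else 0)
    by-cases true  i = refl
    by-cases false i = refl

  degree-cong : ∀ {S S'} → (∀ i → S i ≡ S' i) → ∀ v → degree G S v ≡ degree G S' v
  degree-cong {S} {S'} S≗S' v = begin
    degree G S v            ≡⟨ degree-as-sum S v ⟩
    sum (incidenceIn S v)   ≡⟨ sum-cong-≗ (λ i → cong (λ b → if b then incidence v i else 0) (S≗S' i)) ⟩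
    sum (incidenceIn S' v)  ≡⟨ degree-as-sum S' v ⟨
    degree G S' v           ∎
    where open ≡-Reasoning

  sum-incidence : ∀ i → sum (λ v → incidence v i) ≡ 2
  sum-incidence i =
    trans (∑-distrib-+ (λ v → endCount v (proj₁ (ends G i))) (λ v → endCount v (proj₂ (ends G i))))
          (cong₂ _+_ (sum-endCount (proj₁ (ends G i))) (sum-endCount (proj₂ (ends G i))))

  sum-degree : ∀ S → sum (degree G S) ≡ sum (λ i → if S i then 2 else 0)
  sum-degree S = begin
    sum (degree G S)                                          ≡⟨ sum-cong-≗ (degree-as-sum S) ⟩
    sum (λ v → sum (incidenceIn S v))                         ≡⟨ ∑-comm (λ v i → incidenceIn S v i) ⟩
    sum (λ i → sum (λ v → if S i then incidence v i else 0))  ≡⟨ sum-cong-≗ (λ i → select (S i) i) ⟩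
    sum (λ i → if S i then 2 else 0)                          ∎
    where
    open ≡-Reasoning
    select : ∀ b i → sum (λ v → if b then incidence v i else 0) ≡ (if b then 2 else 0)
    select true  i = sum-incidence i
    select false i = sum-replicate-zero (n G)

  handshake : ∀ S → parity (sum (degree G S)) ≡ 0ℙ
  handshake S = trans (cong parity (sum-degree S)) (parity-sum-even _ λ i → even (S i))
    where
    even : ∀ b → parity (if b then 2 else 0) ≡ 0ℙ
    even true  = refl
    even false = refl

  degree-add-edge : ∀ {S S'} e v → S e ≡ false → S' e ≡ true → (∀ i → i ≢ e → S' i ≡ S i) →
                    degree G S' v ≡ degree G S v + incidence v e
  degree-add-edge {S} {S'} e v absent present agree = begin
    degree G S' v                               ≡⟨ degree-as-sum S' v ⟩
    sum (incidenceIn S' v)                      ≡⟨ sum-insert _ _ e agree-summands (cong (select e) absent) ⟩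
    sum (incidenceIn S v) + incidenceIn S' v e  ≡⟨ cong₂ _+_ (degree-as-sum S v) (cong (select e) (sym present)) ⟨
    degree G S v + incidence v e                ∎
    where
    open ≡-Reasoning
    select : Fin (m G) → Bool → ℕ
    select i b = if b then incidence v i else 0
    agree-summands : ∀ i → i ≢ e → incidenceIn S' v i ≡ incidenceIn S v i
    agree-summands i i≢e = cong (select i) (agree i i≢e)

  parity-degree-flip : ∀ S e v →
    parity (degree G (updateAt S e not) v) ≡ parity (degree G S v) ℙ.+ parity (incidence v e)
  parity-degree-flip S e v with S e in Se
  ... | false =
    trans (cong parity (degree-add-edge e v Se flipped agree)) (+-homo-+ (degree G S v) (incidence v e))
    where
    flipped : updateAt S e not e ≡ true
    flipped = trans (updateAt-updates e S) (cong not Se)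
    agree : ∀ i → i ≢ e → updateAt S e not i ≡ S i
    agree i i≢e = updateAt-minimal i e S i≢e
  ... | true = begin
    parity d'                          ≡⟨ solve 2 (λ p c → p := (p :+ c) :+ c) refl (parity d') c ⟩
    (parity d' ℙ.+ c) ℙ.+ c            ≡⟨ cong (ℙ._+ c) (+-homo-+ d' (incidence v e)) ⟨
    parity (d' + incidence v e) ℙ.+ c  ≡⟨ cong (λ d → parity d ℙ.+ c) removal ⟨
    parity (degree G S v) ℙ.+ c        ∎
    where
    open ≡-Reasoning
    open ℙ-Solver
    d' : ℕ
    d' = degree G (updateAt S e not) v
    c : Parity
    c = parity (incidence v e)
    flipped : updateAt S e not e ≡ false
    flipped = trans (updateAt-updates e S) (cong not Se)
    removal : degree G S v ≡ d' + incidence v e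
    removal = degree-add-edge e v flipped Se (λ i i≢e → sym (updateAt-minimal i e S i≢e))

  parity-incidence : ∀ {S u w e} → Joins G S u w e →
    ∀ x → parity (incidence x e) ≡ parity (endCount x u) ℙ.+ parity (endCount x w)
  parity-incidence {u = u} {w} (_ , inj₁ ends≡uw) x rewrite ends≡uw = +-homo-+ (endCount x u) _
  parity-incidence {u = u} {w} (_ , inj₂ ends≡wu) x rewrite ends≡wu =
    trans (+-homo-+ (endCount x w) _) (ℙ.+-comm (parity (endCount x w)) (parity (endCount x u)))

module EulerianCorrection (G : Graph) (C : EdgeSet G) (C-connected : Connected G C) where

  δ : Fin (n G) → Fin (n G) → Parity
  δ x a = parity (endCount x a)

  flipAlong : ∀ {u v} → Walk G C u v → EdgeSet G → EdgeSet G
  flipAlong []           S = S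
  flipAlong (step e _ w) S = flipAlong w (updateAt S e not)

  flipAlong-outside : ∀ {u v} (w : Walk G C u v) S i → C i ≡ false → flipAlong w S i ≡ S i
  flipAlong-outside []                     S i Ci≡false = refl
  flipAlong-outside (step e (Ce≡true , _) w) S i Ci≡false =
    trans (flipAlong-outside w _ i Ci≡false) (updateAt-minimal i e S i≢e)
    where
    i≢e : i ≢ e
    i≢e refl = contradiction (trans (sym Ci≡false) Ce≡true) λ ()

  parity-degree-flipAlong : ∀ {u v} (w : Walk G C u v) S x →
    parity (degree G (flipAlong w S) x) ≡ parity (degree G S x) ℙ.+ (δ x u ℙ.+ δ x v)
  parity-degree-flipAlong {u} [] S x =
    solve 2 (λ p a → p := p :+ (a :+ a)) refl (parity (degree G S x)) (δ x u)
    where open ℙ-Solver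
  parity-degree-flipAlong {u} {v} (step {w = t} e joins w) S x = begin
    parity (degree G (flipAlong w S') x)             ≡⟨ parity-degree-flipAlong w S' x ⟩
    parity (degree G S' x) ℙ.+ (δ x t ℙ.+ δ x v)     ≡⟨ cong (ℙ._+ (δ x t ℙ.+ δ x v)) flip-e ⟩
    (P ℙ.+ (δ x u ℙ.+ δ x t)) ℙ.+ (δ x t ℙ.+ δ x v)  ≡⟨ cancel-t P (δ x u) (δ x t) (δ x v) ⟩
    P ℙ.+ (δ x u ℙ.+ δ x v)                          ∎
    where
    open ≡-Reasoning
    open ℙ-Solver
    S' : EdgeSet G
    S' = updateAt S e not
    P : Parity
    P = parity (degree G S x)
    cancel-t : ∀ p a b c → (p ℙ.+ (a ℙ.+ b)) ℙ.+ (b ℙ.+ c) ≡ p ℙ.+ (a ℙ.+ c)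
    cancel-t = solve 4 (λ p a b c → (p :+ (a :+ b)) :+ (b :+ c) := p :+ (a :+ c)) refl
    flip-e : parity (degree G S' x) ≡ P ℙ.+ (δ x u ℙ.+ δ x t)
    flip-e = trans (parity-degree-flip G S e x) (cong (P ℙ.+_) (parity-incidence G {C} joins x))

  module _ (r : Fin (n G)) where

    fixVertex : Fin (n G) → EdgeSet G → EdgeSet G
    fixVertex y S with parity (degree G S y)
    ... | 0ℙ = S
    ... | 1ℙ = flipAlong (C-connected y r) S

    fixVertex-outside : ∀ y S i → C i ≡ false → fixVertex y S i ≡ S i
    fixVertex-outside y S i Ci≡false with parity (degree G S y)
    ... | 0ℙ = refl
    ... | 1ℙ = flipAlong-outside (C-connected y r) S i Ci≡false

    fixVertex-fixes : ∀ y S → y ≢ r → parity (degree G (fixVertex y S) y) ≡ 0ℙ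
    fixVertex-fixes y S y≢r with parity (degree G S y) in parity-y
    ... | 0ℙ = parity-y
    ... | 1ℙ = trans (parity-degree-flipAlong (C-connected y r) S y)
                     (cong₂ ℙ._+_ parity-y (cong₂ ℙ._+_ (cong parity (endCount-self y))
                                                        (cong parity (endCount-other (y≢r ∘ sym)))))

    fixVertex-preserves : ∀ y S x → x ≢ r → parity (degree G S x) ≡ 0ℙ →
                          parity (degree G (fixVertex y S) x) ≡ 0ℙ
    fixVertex-preserves y S x x≢r even with parity (degree G S y) in parity-y
    ... | 0ℙ = even
    ... | 1ℙ = trans (parity-degree-flipAlong (C-connected y r) S x)
                     (cong₂ ℙ._+_ even (cong₂ ℙ._+_ (cong parity (endCount-other (x≢y ∘ sym)))
                                                     (cong parity (endCount-other (x≢r ∘ sym)))))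
      where
      x≢y : x ≢ y
      x≢y refl with () ← trans (sym even) parity-y

    fixAll : List (Fin (n G)) → EdgeSet G → EdgeSet G
    fixAll []       S = S
    fixAll (y ∷ ys) S = fixAll ys (fixVertex y S)

    fixAll-outside : ∀ ys S i → C i ≡ false → fixAll ys S i ≡ S i
    fixAll-outside []       S i Ci≡false = refl
    fixAll-outside (y ∷ ys) S i Ci≡false =
      trans (fixAll-outside ys _ i Ci≡false) (fixVertex-outside y S i Ci≡false)

    fixAll-preserves : ∀ ys S x → x ≢ r → parity (degree G S x) ≡ 0ℙ →
                       parity (degree G (fixAll ys S) x) ≡ 0ℙ
    fixAll-preserves []       S x x≢r even = even
    fixAll-preserves (y ∷ ys) S x x≢r even =
      fixAll-preserves ys _ x x≢r (fixVertex-preserves y S x x≢r even)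

    fixAll-fixes : ∀ ys S {x} → x ∈ ys → x ≢ r → parity (degree G (fixAll ys S) x) ≡ 0ℙ
    fixAll-fixes (y ∷ ys) S (here refl) x≢r = fixAll-preserves ys _ y x≢r (fixVertex-fixes y S x≢r)
    fixAll-fixes (y ∷ ys) S (there x∈ys) x≢r = fixAll-fixes ys _ x∈ys x≢r

    fixAll-eulerian : ∀ S → Eulerian G (fixAll (allFin (n G)) S)
    fixAll-eulerian S v with v ≟ r
    ... | yes refl =
      parity≡0ℙ⇒2∣ _ (trans (sym (parity-sum-single (degree G S') r others-even)) (handshake G S'))
      where
      S' : EdgeSet G
      S' = fixAll (allFin (n G)) S
      others-even : ∀ x → x ≢ r → parity (degree G S' x) ≡ 0ℙ
      others-even x = fixAll-fixes (allFin (n G)) S (∈-allFin x)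
    ... | no v≢r = parity≡0ℙ⇒2∣ _ (fixAll-fixes (allFin (n G)) S (∈-allFin v) v≢r)

inhabited? : ∀ k → Dec (Fin k)
inhabited? zero    = no ¬Fin0
inhabited? (suc k) = yes zero

eulerian-correction : ∀ G (C : EdgeSet G) → Connected G C → (S : EdgeSet G) →
  Σ (EdgeSet G) λ S' → (∀ i → C i ≡ false → S' i ≡ S i) × Eulerian G S'
eulerian-correction G C C-connected S with inhabited? (n G)
... | yes r = fixAll r (allFin (n G)) S , fixAll-outside r (allFin (n G)) S , fixAll-eulerian r S
  where open EulerianCorrection G C C-connected
... | no no-vertex = S , (λ _ _ → refl) , λ v → contradiction v no-vertex

EdgeDisjoint : ∀ {K} (G : Graph) → (Fin K → EdgeSet G) → Set
EdgeDisjoint G T = ∀ j j' i → T j i ≡ true → T j' i ≡ true → j ≡ j'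

TreeConnected-select : ∀ {G K k S} (T : Fin K → EdgeSet G) →
  (∀ j → Connected G (T j) × Acyclic G (T j)) → EdgeDisjoint G T →
  (ι : Fin k → Fin K) → (∀ j j' → ι j ≡ ι j' → j ≡ j') → (∀ j → SubEdges G (T (ι j)) S) →
  TreeConnected k G S
TreeConnected-select T trees disjoint ι ι-injective inside =
  T ∘ ι , (λ j → inside j , trees (ι j)) , λ j j' i p q → ι-injective j j' (disjoint _ _ i p q)

↑ˡ≢↑ʳ : ∀ {m n} (i : Fin m) (j : Fin n) → i ↑ˡ n ≢ m ↑ʳ j
↑ˡ≢↑ʳ {m} {n} i j eq
  with () ← trans (sym (splitAt-↑ˡ m i n)) (trans (cong (splitAt m) eq) (splitAt-↑ʳ m n j))

module Decomposition (G : Graph) (X : VertexSet G) (m₁ m₂ : ℕ)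
  (T : Fin (m₁ + m₂ + 1) → EdgeSet G) (spanning : ∀ j → SpanningTree G (Cross G X) (T j))
  (disjoint : EdgeDisjoint G T) where

  first : Fin m₁ → Fin (m₁ + m₂ + 1)
  first j = (j ↑ˡ m₂) ↑ˡ 1

  second : Fin m₂ → Fin (m₁ + m₂ + 1)
  second j = (m₁ ↑ʳ j) ↑ˡ 1

  spare : Fin (m₁ + m₂ + 1)
  spare = (m₁ + m₂) ↑ʳ zero

  first-injective : ∀ j j' → first j ≡ first j' → j ≡ j'
  first-injective j j' = ↑ˡ-injective m₂ j j' ∘ ↑ˡ-injective 1 _ _

  second-injective : ∀ j j' → second j ≡ second j' → j ≡ j'
  second-injective j j' = ↑ʳ-injective m₁ j j' ∘ ↑ˡ-injective 1 _ _

  first≢second : ∀ j j' → first j ≢ second j'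
  first≢second j j' = ↑ˡ≢↑ʳ j j' ∘ ↑ˡ-injective 1 _ _

  off-spare : ∀ {j i} → j ≢ spare → T j i ≡ true → T spare i ≡ false
  off-spare {j} {i} j≢spare Tji = ¬-not λ Tspare → j≢spare (disjoint j spare i Tji Tspare)

  inFirst : Fin (m G) → Bool
  inFirst i = does (any? λ j → T (first j) i ≟ᵇ true)

  inFirst-witness : ∀ i → inFirst i ≡ true → ∃ λ j → T (first j) i ≡ true
  inFirst-witness i with any? (λ j → T (first j) i ≟ᵇ true)
  ... | yes found = λ _ → found
  ... | no _      = λ ()

  correction : Σ (EdgeSet G) λ S → (∀ i → T spare i ≡ false → S i ≡ not (inFirst i)) × Eulerian G S
  correction = eulerian-correction G (T spare) (proj₁ (proj₂ (spanning spare))) (not ∘ inFirst)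

  E₂ : EdgeSet G
  E₂ = proj₁ correction

  E₂-off-spare : ∀ i → T spare i ≡ false → E₂ i ≡ not (inFirst i)
  E₂-off-spare = proj₁ (proj₂ correction)

  E₁ : EdgeSet G
  E₁ i = not (E₂ i)

  E₁-off-spare : ∀ i → T spare i ≡ false → E₁ i ≡ inFirst i
  E₁-off-spare i spare-i = trans (cong not (E₂-off-spare i spare-i)) (not-involutive (inFirst i))

  E₁-bipartite : BipartiteWith G X E₁
  E₁-bipartite i E₁i with T spare i in spare-i
  ... | true  = proj₁ (spanning spare) i spare-i
  ... | false with j , Tji ← inFirst-witness i (trans (sym (E₁-off-spare i spare-i)) E₁i) =
    proj₁ (spanning (first j)) i Tji

  first⊆E₁ : ∀ j → SubEdges G (T (first j)) E₁
  first⊆E₁ j i Tji = trans (E₁-off-spare i (off-spare (↑ˡ≢↑ʳ _ _) Tji))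
                            (dec-true (any? λ j → T (first j) i ≟ᵇ true) (j , Tji))

  second⊆E₂ : ∀ j → SubEdges G (T (second j)) (λ i → not (E₁ i))
  second⊆E₂ j i Tji = begin
    not (not (E₂ i))   ≡⟨ not-involutive (E₂ i) ⟩
    E₂ i               ≡⟨ E₂-off-spare i (off-spare (↑ˡ≢↑ʳ _ _) Tji) ⟩
    not (inFirst i)    ≡⟨ cong not (dec-false (any? λ j → T (first j) i ≟ᵇ true) not-in-first) ⟩
    true               ∎
    where
    open ≡-Reasoning
    not-in-first : ¬ ∃ λ j' → T (first j') i ≡ true
    not-in-first (j' , Tj'i) = first≢second j' j (disjoint _ _ i Tj'i Tji)

  E₂-eulerian : Eulerian G (λ i → not (E₁ i))
  E₂-eulerian v =
    subst (2 ∣_) (degree-cong G (λ i → sym (not-involutive (E₂ i))) v) (proj₂ (proj₂ correction) v)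

lemma2p4 : (G : Graph) (X : VertexSet G) (m₁ m₂ : ℕ) →
    TreeConnected (m₁ + m₂ + 1) G (Cross G X) →
    Σ (EdgeSet G) λ E₁ →
      BipartiteWith G X E₁ × TreeConnected m₁ G E₁ ×
      TreeConnected m₂ G (λ i → not (E₁ i)) × Eulerian G (λ i → not (E₁ i))
lemma2p4 G X m₁ m₂ (T , spanning , disjoint) =
  E₁ , E₁-bipartite ,
  TreeConnected-select T trees disjoint first first-injective first⊆E₁ ,
  TreeConnected-select T trees disjoint second second-injective second⊆E₂ ,
  E₂-eulerian
  where
  open Decomposition G X m₁ m₂ T spanning disjoint
  trees : ∀ j → Connected G (T j) × Acyclic G (T j)
  trees j = proj₂ (spanning j)
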